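{- Let $k\ge 3$. For every $n\ge k$, $W^{(k)}_n=W^{(k)}_{n-1}W^{(k)}_{n-2}\cdots W^{(k)}_{n-k+1}\,\big(k\oplus W^{(k)}_{n-k}\big)$.
   Context: The alphabet is $\mathbb{N}=\{0,1,2,\dots\}$. For an integer $k\ge 3$, $\varphi_k$ is the morphism of $\mathbb{N}^*$ defined on letters, for $i\ge 0$ and $0\le j\le k-1$, by $\varphi_k(ki+j)=(ki)(ki+j+1)$ (two letters) if $0\le j\le k-2$, and $\varphi_k(ki+k-1)=(ki+k)$ (one letter). For $n\ge 0$, $W^{(k)}_n=\varphi_k^n(0)$. For a finite word $W$ and an integer $m$, $m\oplus W$ is the word obtained by adding $m$ to each letter of $W$. -}

module Defs where

open import Data.Nat using (ℕ; zero; suc; _+_; _*_; _∸_; _<_; _≟_; NonZero)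
open import Data.Nat.DivMod using (_/_; _%_)
open import Data.List using (List; []; _∷_; _++_; concatMap; map; applyUpTo)
open import Relation.Nullary using (yes; no)

Word : Set
Word = List ℕ

φLetter : (k : ℕ) → .{{NonZero k}} → ℕ → Word
φLetter k a with a % k ≟ k ∸ 1
... | yes _ = (a + 1) ∷ []
... | no  _ = (k * (a / k)) ∷ (a + 1) ∷ []

φ : (k : ℕ) → .{{NonZero k}} → Word → Word
φ k w = concatMap (φLetter k) w

φ^ : (k : ℕ) → .{{NonZero k}} → ℕ → Word → Word
φ^ k zero    w = w
φ^ k (suc n) w = φ k (φ^ k n w)

W : (k : ℕ) → .{{NonZero k}} → ℕ → Word
W k n = φ^ k n (0 ∷ [])

_⊕_ : ℕ → Word → Word
m ⊕ w = map (m +_) w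

prefixBlock : (k : ℕ) → .{{NonZero k}} → ℕ → Word
prefixBlock k n = concatMap (λ i → W k (n ∸ suc i)) (applyUpTo (λ i → i) (k ∸ 1))

-- φ_k is a morphism, and it commutes with k ⊕ _ because shifting a letter by k
-- shifts its image by k. Applying φ_k to W_{n-1} ⋯ W_{n-m} gives W_n ⋯ W_{n-m+1}, so
-- applying φ_k to the recurrence at n yields the recurrence at n + 1. For the base
-- case, induction gives W_n = W_{n-1} ⋯ W_0 n for n < k (the last letter n is not
-- ≡ k - 1 mod k, so φ_k(n) = 0 (n+1) and the new 0 is W_0); one more application
-- turns the final letter k - 1 into k = k ⊕ W_0, which is the recurrence at n = k.
module Submission where

open import Defs
open import Data.Nat using (ℕ; zero; suc; _+_; _*_; _≤_; _<_; _∸_; _≟_; NonZero; >-nonZero⁻¹)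
open import Data.Nat.Properties
open import Data.Nat.DivMod using (_/_; _%_; [m+n]%n≡m%n; m/n≡1+[m∸n]/n; m<n⇒m%n≡m; m<n⇒m/n≡0)
open import Data.List using ([]; _∷_; [_]; _++_; concatMap; map; applyUpTo)
open import Data.List.Properties
  using (concatMap-++; concatMap-cong; concatMap-map; map-concatMap; ++-assoc; ++-identityʳ; applyUpTo-∷ʳ)
open import Function using (id; _∘_)
open import Relation.Nullary using (¬_; Dec; yes; no; contradiction)
open import Relation.Binary.PropositionalEquality using (_≡_; refl; sym; trans; cong; cong₂; module ≡-Reasoning)
open ≡-Reasoning

module _ {k : ℕ} .{{_ : NonZero k}} where

  φLetter-last : ∀ a → a % k ≡ k ∸ 1 → φLetter k a ≡ [ a + 1 ]
  φLetter-last a a%k≡k∸1 with a % k ≟ k ∸ 1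
  ... | yes _ = refl
  ... | no a%k≢k∸1 = contradiction a%k≡k∸1 a%k≢k∸1

  φLetter-notLast : ∀ a → ¬ a % k ≡ k ∸ 1 → φLetter k a ≡ k * (a / k) ∷ a + 1 ∷ []
  φLetter-notLast a a%k≢k∸1 with a % k ≟ k ∸ 1
  ... | yes a%k≡k∸1 = contradiction a%k≡k∸1 a%k≢k∸1
  ... | no _ = refl

  φ-++ : ∀ u v → φ k (u ++ v) ≡ φ k u ++ φ k v
  φ-++ = concatMap-++ (φLetter k)

  [k+a]%k≡a%k : ∀ a → (k + a) % k ≡ a % k
  [k+a]%k≡a%k a = trans (cong (_% k) (+-comm k a)) ([m+n]%n≡m%n a k)

  k*[[k+a]/k]≡k+k*[a/k] : ∀ a → k * ((k + a) / k) ≡ k + k * (a / k)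
  k*[[k+a]/k]≡k+k*[a/k] a = begin
    k * ((k + a) / k)          ≡⟨ cong (k *_) (m/n≡1+[m∸n]/n (m≤m+n k a)) ⟩
    k * suc ((k + a ∸ k) / k)  ≡⟨ cong (λ x → k * suc (x / k)) (m+n∸m≡n k a) ⟩
    k * suc (a / k)            ≡⟨ *-suc k (a / k) ⟩
    k + k * (a / k)            ∎

  φLetter-⊕ : ∀ a → φLetter k (k + a) ≡ k ⊕ φLetter k a
  φLetter-⊕ a = by-cases (a % k ≟ k ∸ 1)
    where
      by-cases : Dec (a % k ≡ k ∸ 1) → φLetter k (k + a) ≡ k ⊕ φLetter k a
      by-cases (yes a%k≡k∸1) = begin
        φLetter k (k + a)  ≡⟨ φLetter-last (k + a) (trans ([k+a]%k≡a%k a) a%k≡k∸1) ⟩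
        [ k + a + 1 ]      ≡⟨ cong [_] (+-assoc k a 1) ⟩
        k ⊕ [ a + 1 ]      ≡⟨ cong (k ⊕_) (φLetter-last a a%k≡k∸1) ⟨
        k ⊕ φLetter k a    ∎
      by-cases (no a%k≢k∸1) = begin
        φLetter k (k + a)                   ≡⟨ φLetter-notLast (k + a) (a%k≢k∸1 ∘ trans (sym ([k+a]%k≡a%k a))) ⟩
        k * ((k + a) / k) ∷ k + a + 1 ∷ []  ≡⟨ cong₂ (λ x y → x ∷ y ∷ []) (k*[[k+a]/k]≡k+k*[a/k] a) (+-assoc k a 1) ⟩
        k ⊕ (k * (a / k) ∷ a + 1 ∷ [])      ≡⟨ cong (k ⊕_) (φLetter-notLast a a%k≢k∸1) ⟨
        k ⊕ φLetter k a                     ∎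

  φ-⊕ : ∀ w → φ k (k ⊕ w) ≡ k ⊕ φ k w
  φ-⊕ w = begin
    concatMap (φLetter k) (map (k +_) w)   ≡⟨ concatMap-map (φLetter k) (k +_) w ⟩
    concatMap (λ a → φLetter k (k + a)) w  ≡⟨ concatMap-cong φLetter-⊕ w ⟩
    concatMap (λ a → k ⊕ φLetter k a) w    ≡⟨ map-concatMap (k +_) (φLetter k) w ⟨
    k ⊕ φ k w                              ∎

  block : ℕ → ℕ → Word
  block n zero    = []
  block n (suc m) = block n m ++ W k (n ∸ suc m)

  φ-block : ∀ n m → m ≤ n → φ k (block n m) ≡ block (suc n) m
  φ-block n zero    _   = refl
  φ-block n (suc m) m<n = begin
    φ k (block n m ++ W k (n ∸ suc m))        ≡⟨ φ-++ (block n m) (W k (n ∸ suc m)) ⟩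
    φ k (block n m) ++ W k (suc (n ∸ suc m))  ≡⟨ cong₂ _++_ (φ-block n m (<⇒≤ m<n)) (cong (W k) (sym (+-∸-assoc 1 m<n))) ⟩
    block (suc n) (suc m)                     ∎

  concatMap-W-applyUpTo : ∀ n m → concatMap (λ i → W k (n ∸ suc i)) (applyUpTo id m) ≡ block n m
  concatMap-W-applyUpTo n zero    = refl
  concatMap-W-applyUpTo n (suc m) = begin
    concatMap Wₙ₋₁₋ (applyUpTo id (suc m))      ≡⟨ cong (concatMap Wₙ₋₁₋) (applyUpTo-∷ʳ id m) ⟨
    concatMap Wₙ₋₁₋ (applyUpTo id m ++ [ m ])   ≡⟨ concatMap-++ Wₙ₋₁₋ (applyUpTo id m) [ m ] ⟩
    concatMap Wₙ₋₁₋ (applyUpTo id m) ++ (Wₙ₋₁₋ m ++ [])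
      ≡⟨ cong₂ _++_ (concatMap-W-applyUpTo n m) (++-identityʳ (Wₙ₋₁₋ m)) ⟩
    block n (suc m)                             ∎
    where
      Wₙ₋₁₋ : ℕ → Word
      Wₙ₋₁₋ i = W k (n ∸ suc i)

  1+[k∸1]≡k : suc (k ∸ 1) ≡ k
  1+[k∸1]≡k = sym (+-∸-assoc 1 (>-nonZero⁻¹ k))

  k∸1<k : k ∸ 1 < k
  k∸1<k = ≤-reflexive 1+[k∸1]≡k

  φLetter-below : ∀ n → suc n < k → φLetter k n ≡ 0 ∷ suc n ∷ []
  φLetter-below n 1+n<k = begin
    φLetter k n                  ≡⟨ φLetter-notLast n n%k≢k∸1 ⟩
    k * (n / k) ∷ n + 1 ∷ []     ≡⟨ cong₂ (λ x y → x ∷ y ∷ []) k*[n/k]≡0 (+-comm n 1) ⟩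
    0 ∷ suc n ∷ []               ∎
    where
      n<k : n < k
      n<k = <-trans (n<1+n n) 1+n<k
      n%k≢k∸1 : ¬ n % k ≡ k ∸ 1
      n%k≢k∸1 n%k≡k∸1 = <-irrefl (trans (sym (m<n⇒m%n≡m n<k)) n%k≡k∸1) (∸-monoˡ-≤ 1 1+n<k)
      k*[n/k]≡0 : k * (n / k) ≡ 0
      k*[n/k]≡0 = trans (cong (k *_) (m<n⇒m/n≡0 n<k)) (*-zeroʳ k)

  φLetter-k∸1 : φLetter k (k ∸ 1) ≡ [ k ]
  φLetter-k∸1 = trans (φLetter-last (k ∸ 1) (m<n⇒m%n≡m k∸1<k))
                      (cong [_] (trans (+-comm (k ∸ 1) 1) 1+[k∸1]≡k))

  W-suc : ∀ n → W k n ≡ block n n ++ [ n ] → W k (suc n) ≡ block (suc n) n ++ φLetter k n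
  W-suc n Wₙ≡ = begin
    φ k (W k n)                              ≡⟨ cong (φ k) Wₙ≡ ⟩
    φ k (block n n ++ [ n ])                 ≡⟨ φ-++ (block n n) [ n ] ⟩
    φ k (block n n) ++ (φLetter k n ++ [])   ≡⟨ cong₂ _++_ (φ-block n n ≤-refl) (++-identityʳ (φLetter k n)) ⟩
    block (suc n) n ++ φLetter k n           ∎

  W-below : ∀ n → n < k → W k n ≡ block n n ++ [ n ]
  W-below zero    _     = refl
  W-below (suc n) 1+n<k = begin
    W k (suc n)                               ≡⟨ W-suc n (W-below n (<-trans (n<1+n n) 1+n<k)) ⟩
    block (suc n) n ++ φLetter k n            ≡⟨ cong (block (suc n) n ++_) (φLetter-below n 1+n<k) ⟩
    block (suc n) n ++ [ 0 ] ++ [ suc n ]     ≡⟨ ++-assoc (block (suc n) n) [ 0 ] [ suc n ] ⟨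
    (block (suc n) n ++ W k 0) ++ [ suc n ]   ≡⟨ cong (λ x → (block (suc n) n ++ W k x) ++ [ suc n ]) (n∸n≡0 n) ⟨
    block (suc n) (suc n) ++ [ suc n ]        ∎

  W-recurrence-base : W k k ≡ block k (k ∸ 1) ++ (k ⊕ W k 0)
  W-recurrence-base = begin
    W k k                                         ≡⟨ cong (W k) 1+[k∸1]≡k ⟨
    W k (suc (k ∸ 1))                             ≡⟨ W-suc (k ∸ 1) (W-below (k ∸ 1) k∸1<k) ⟩
    block (suc (k ∸ 1)) (k ∸ 1) ++ φLetter k (k ∸ 1)
      ≡⟨ cong₂ (λ n w → block n (k ∸ 1) ++ w) 1+[k∸1]≡k φLetter-k∸1 ⟩
    block k (k ∸ 1) ++ [ k ]                      ≡⟨ cong (λ x → block k (k ∸ 1) ++ [ x ]) (+-identityʳ k) ⟨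
    block k (k ∸ 1) ++ (k ⊕ W k 0)                ∎

  W-recurrence : ∀ d → W k (d + k) ≡ block (d + k) (k ∸ 1) ++ (k ⊕ W k d)
  W-recurrence zero    = W-recurrence-base
  W-recurrence (suc d) = begin
    φ k (W k (d + k))                                      ≡⟨ cong (φ k) (W-recurrence d) ⟩
    φ k (block (d + k) (k ∸ 1) ++ (k ⊕ W k d))             ≡⟨ φ-++ (block (d + k) (k ∸ 1)) (k ⊕ W k d) ⟩
    φ k (block (d + k) (k ∸ 1)) ++ φ k (k ⊕ W k d)
      ≡⟨ cong₂ _++_ (φ-block (d + k) (k ∸ 1) (≤-trans (m∸n≤m k 1) (m≤n+m k d))) (φ-⊕ (W k d)) ⟩
    block (suc d + k) (k ∸ 1) ++ (k ⊕ W k (suc d))         ∎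

-- The recurrence holds for every k ≥ 1.
lemma4p3 : (k : ℕ) → .{{_ : NonZero k}} → 3 ≤ k → (n : ℕ) → k ≤ n →
    W k n ≡ prefixBlock k n ++ (k ⊕ W k (n ∸ k))
lemma4p3 k _ n k≤n = begin
  W k n                                           ≡⟨ cong (W k) (m∸n+n≡m k≤n) ⟨
  W k (n ∸ k + k)                                 ≡⟨ W-recurrence (n ∸ k) ⟩
  block (n ∸ k + k) (k ∸ 1) ++ (k ⊕ W k (n ∸ k))  ≡⟨ cong (λ m → block m (k ∸ 1) ++ (k ⊕ W k (n ∸ k))) (m∸n+n≡m k≤n) ⟩
  block n (k ∸ 1) ++ (k ⊕ W k (n ∸ k))            ≡⟨ cong (_++ (k ⊕ W k (n ∸ k))) (concatMap-W-applyUpTo n (k ∸ 1)) ⟨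
  prefixBlock k n ++ (k ⊕ W k (n ∸ k))            ∎
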